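{- Let $h(x)$ be a polynomial with real coefficients and for $n\ge1$, $0\le l\le\lfloor n/2\rfloor$ let $L_{h,n}^l(x)=\sum_{i=0}^{l}\frac{n}{n-i}\binom{n-i}{i}h^{n-2i}(x)$. Then for all integers $l\ge0$, $n\ge 2l+1$ and $s\ge1$, $$\sum_{i=0}^{s-1}L_{h,n+i}^{l}(x)\,h^{s-1-i}(x)=L_{h,n+s+1}^{l+1}(x)-h^{s}(x)L_{h,n+1}^{l+1}(x).$$
   Context: $h(x)$ is a polynomial with real coefficients; $h^k(x)$ denotes $(h(x))^k$. $L_{h,n}^l$ are the incomplete $h(x)$-Lucas polynomials. -}

module Defs where

open import Level using (Level)
open import Data.Nat using (ℕ; zero; suc; _∸_; _/_) renaming (_+_ to _+ℕ_; _*_ to _*ℕ_)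
open import Data.Nat.Combinatorics using (_C_)
open import Algebra.Bundles using (CommutativeRing)

-- For 1 ≤ n and 0 ≤ i ≤ ⌊n/2⌋ we have n - i ≥ 1 and the division
-- n * C(n-i,i) / (n-i) is exact, so this is exactly the paper's coefficient.
-- (The n - i = 0 branch never occurs in the range used.)
coeff : ℕ → ℕ → ℕ
coeff n i with n ∸ i
... | zero  = 0
... | suc k = (n *ℕ ((suc k) C i)) / (suc k)

module _ {c ℓ : Level} (R : CommutativeRing c ℓ) where
  open CommutativeRing R

  pow : Carrier → ℕ → Carrier
  pow h zero    = 1#
  pow h (suc n) = h * pow h n

  nat· : ℕ → Carrier → Carrier
  nat· zero    x = 0#
  nat· (suc k) x = x + nat· k x

  sumBelow : ℕ → (ℕ → Carrier) → Carrier
  sumBelow zero    f = 0#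
  sumBelow (suc m) f = sumBelow m f + f m

  -- incomplete h-Lucas polynomial (evaluated at the value h = h(x)):
  -- L_{h,n}^l = Σ_{i=0}^{l} n/(n-i) C(n-i,i) h^{n-2i}
  incLucas : Carrier → ℕ → ℕ → Carrier
  incLucas h n l = sumBelow (suc l) (λ i → nat· (coeff n i) (pow h (n ∸ (2 *ℕ i))))

-- Both sides, as functions of s, satisfy T(0) = 0 and T(s+1) = h T(s) + L_{h,n+s}^l:
-- for the left side this is Horner's rule, for the right side it is the recurrence
-- L_{h,m+2}^{l+1} = h L_{h,m+1}^{l+1} + L_{h,m}^l (for m ≥ 2l+1). Termwise, that
-- recurrence is Pascal's rule for the coefficients, once they are written as
-- m/(m-i) C(m-i,i) = C(m-i,i) + C(m-i-1,i-1).
module Submission where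

open import Defs
open import Level using (Level)
open import Data.Nat using (ℕ; zero; suc; _≤_; _<_; _∸_; _/_; s≤s) renaming (_+_ to _+ℕ_; _*_ to _*ℕ_)
import Data.Nat.Properties as ℕₚ
open import Data.Nat.Combinatorics using (_C_; nC1≡n; nCk+nC[k+1]≡[n+1]C[k+1])
open import Data.Nat.DivMod using (m*n/n≡m)
open import Data.Nat.Tactic.RingSolver using (solve-∀)
open import Data.Product using (_,_)
open import Algebra.Bundles using (CommutativeRing)
import Algebra.Properties.Ring as RingProperties
import Algebra.Properties.Semiring.Mult as SemiringMultProperties
import Algebra.Properties.CommutativeSemigroup as CommutativeSemigroupProperties
open import Relation.Binary.PropositionalEquality as ≡ using (_≡_; cong; cong₂)
import Relation.Binary.Reasoning.Setoid as SetoidReasoning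

module LucasCoefficient where
  open ℕₚ using (*-comm; *-zeroʳ; *-identityʳ; +-identityʳ; +-comm; +-assoc; *-distribˡ-+; *-distribʳ-+; +-suc; m+n∸m≡n; m≤n⇒∃[o]m+o≡n)
  open ≡ using (refl; sym; trans; subst; module ≡-Reasoning)

  [1+n]*nCk≡[1+k]*[1+n]C[1+k] : ∀ n k → suc n *ℕ (n C k) ≡ suc k *ℕ (suc n C suc k)
  [1+n]*nCk≡[1+k]*[1+n]C[1+k] zero    zero    = refl
  [1+n]*nCk≡[1+k]*[1+n]C[1+k] zero    (suc k) = sym (*-zeroʳ (suc (suc k)))
  [1+n]*nCk≡[1+k]*[1+n]C[1+k] (suc n) zero    =
    trans (*-identityʳ (suc (suc n))) (sym (trans (+-identityʳ _) (nC1≡n (suc (suc n)))))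
  [1+n]*nCk≡[1+k]*[1+n]C[1+k] (suc n) (suc k) = begin
      suc (suc n) *ℕ c
    ≡⟨⟩
      c +ℕ suc n *ℕ c
    ≡⟨ cong (λ z → c +ℕ suc n *ℕ z) (sym (nCk+nC[k+1]≡[n+1]C[k+1] n k)) ⟩
      c +ℕ suc n *ℕ (n C k +ℕ n C suc k)
    ≡⟨ cong (c +ℕ_) (*-distribˡ-+ (suc n) (n C k) (n C suc k)) ⟩
      c +ℕ (suc n *ℕ (n C k) +ℕ suc n *ℕ (n C suc k))
    ≡⟨ cong₂ (λ x y → c +ℕ (x +ℕ y)) ([1+n]*nCk≡[1+k]*[1+n]C[1+k] n k) ([1+n]*nCk≡[1+k]*[1+n]C[1+k] n (suc k)) ⟩
      c +ℕ (suc k *ℕ c +ℕ suc (suc k) *ℕ d)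
    ≡⟨ sym (+-assoc c (suc k *ℕ c) _) ⟩
      suc (suc k) *ℕ c +ℕ suc (suc k) *ℕ d
    ≡⟨ sym (*-distribˡ-+ (suc (suc k)) c d) ⟩
      suc (suc k) *ℕ (c +ℕ d)
    ≡⟨ cong (suc (suc k) *ℕ_) (nCk+nC[k+1]≡[n+1]C[k+1] (suc n) (suc k)) ⟩
      suc (suc k) *ℕ (suc (suc n) C suc (suc k))
    ∎
    where
    open ≡-Reasoning
    c = suc n C suc k
    d = suc n C suc (suc k)

  binomialPred : ℕ → ℕ → ℕ
  binomialPred n zero    = 0
  binomialPred n (suc k) = n C k

  k*[1+n]Ck≡[1+n]*binomialPred : ∀ n k → k *ℕ (suc n C k) ≡ suc n *ℕ binomialPred n k
  k*[1+n]Ck≡[1+n]*binomialPred n zero    = sym (*-zeroʳ (suc n))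
  k*[1+n]Ck≡[1+n]*binomialPred n (suc k) = sym ([1+n]*nCk≡[1+k]*[1+n]C[1+k] n k)

  [1+n]Ck≡nCk+binomialPred : ∀ n k → suc n C k ≡ n C k +ℕ binomialPred n k
  [1+n]Ck≡nCk+binomialPred n zero    = refl
  [1+n]Ck≡nCk+binomialPred n (suc k) = trans (sym (nCk+nC[k+1]≡[n+1]C[k+1] n k)) (+-comm (n C k) _)

  coeff-unfold : ∀ n k {m} → n ∸ k ≡ suc m → coeff n k ≡ (n *ℕ (suc m C k)) / suc m
  coeff-unfold n k eq rewrite eq = refl

  coeff-binomial : ∀ k n → coeff (k +ℕ suc n) k ≡ suc n C k +ℕ binomialPred n k
  coeff-binomial k n = begin
      coeff (k +ℕ suc n) k
    ≡⟨ coeff-unfold (k +ℕ suc n) k (m+n∸m≡n k (suc n)) ⟩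
      ((k +ℕ suc n) *ℕ X) / suc n
    ≡⟨ cong (_/ suc n) numerator ⟩
      ((X +ℕ binomialPred n k) *ℕ suc n) / suc n
    ≡⟨ m*n/n≡m (X +ℕ binomialPred n k) (suc n) ⟩
      X +ℕ binomialPred n k
    ∎
    where
    open ≡-Reasoning
    X = suc n C k
    numerator : (k +ℕ suc n) *ℕ X ≡ (X +ℕ binomialPred n k) *ℕ suc n
    numerator = begin
        (k +ℕ suc n) *ℕ X
      ≡⟨ *-distribʳ-+ X k (suc n) ⟩
        k *ℕ X +ℕ suc n *ℕ X
      ≡⟨ cong (_+ℕ suc n *ℕ X) (k*[1+n]Ck≡[1+n]*binomialPred n k) ⟩
        suc n *ℕ binomialPred n k +ℕ suc n *ℕ X
      ≡⟨ +-comm (suc n *ℕ binomialPred n k) _ ⟩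
        suc n *ℕ X +ℕ suc n *ℕ binomialPred n k
      ≡⟨ sym (*-distribˡ-+ (suc n) X (binomialPred n k)) ⟩
        suc n *ℕ (X +ℕ binomialPred n k)
      ≡⟨ *-comm (suc n) _ ⟩
        (X +ℕ binomialPred n k) *ℕ suc n
      ∎

  coeff-zero : ∀ n → coeff (suc n) 0 ≡ 1
  coeff-zero n = coeff-binomial 0 n

  coeff-pascal : ∀ {n k} → k < n → coeff (2 +ℕ n) (1 +ℕ k) ≡ coeff (1 +ℕ n) (1 +ℕ k) +ℕ coeff n k
  coeff-pascal {n} {k} k<n with m≤n⇒∃[o]m+o≡n k<n
  ... | j , 1+k+j≡n =
    subst (λ m → coeff (2 +ℕ m) (1 +ℕ k) ≡ coeff (1 +ℕ m) (1 +ℕ k) +ℕ coeff m k)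
          (trans (+-suc k j) 1+k+j≡n) pascal
    where
    open ≡-Reasoning
    rearrange : ∀ a x y b → (x +ℕ y) +ℕ a +ℕ b ≡ (a +ℕ x) +ℕ (b +ℕ y)
    rearrange = solve-∀
    pascal : coeff (2 +ℕ (k +ℕ suc j)) (1 +ℕ k)
             ≡ coeff (1 +ℕ (k +ℕ suc j)) (1 +ℕ k) +ℕ coeff (k +ℕ suc j) k
    pascal = begin
        coeff (2 +ℕ (k +ℕ suc j)) (suc k)
      ≡⟨ cong (λ m → coeff (suc m) (suc k)) (sym (+-suc k (suc j))) ⟩
        coeff (suc k +ℕ suc (suc j)) (suc k)
      ≡⟨ coeff-binomial (suc k) (suc j) ⟩
        suc (suc j) C suc k +ℕ suc j C k
      ≡⟨ cong (_+ℕ suc j C k) (sym (nCk+nC[k+1]≡[n+1]C[k+1] (suc j) k)) ⟩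
        suc j C k +ℕ suc j C suc k +ℕ suc j C k
      ≡⟨ cong (λ z → z +ℕ suc j C suc k +ℕ suc j C k) ([1+n]Ck≡nCk+binomialPred j k) ⟩
        (j C k +ℕ binomialPred j k) +ℕ suc j C suc k +ℕ suc j C k
      ≡⟨ rearrange (suc j C suc k) (j C k) (binomialPred j k) (suc j C k) ⟩
        (suc j C suc k +ℕ j C k) +ℕ (suc j C k +ℕ binomialPred j k)
      ≡⟨ sym (cong₂ _+ℕ_ (coeff-binomial (suc k) j) (coeff-binomial k j)) ⟩
        coeff (suc k +ℕ suc j) (suc k) +ℕ coeff (k +ℕ suc j) k
      ∎

open LucasCoefficient

module _ {c ℓ : Level} (R : CommutativeRing c ℓ) (h : CommutativeRing.Carrier R) where
  open CommutativeRing R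
  open RingProperties ring using (x[y-z]≈xy-xz)
  open SemiringMultProperties semiring using (_×_; ×-homo-+; ×-comm-*)
  open CommutativeSemigroupProperties +-commutativeSemigroup using (interchange; xy∙z≈xz∙y)
  open CommutativeSemigroupProperties *-commutativeSemigroup using (x∙yz≈y∙xz)
  open SetoidReasoning setoid

  sumBelow-cong : ∀ m {f g : ℕ → Carrier} → (∀ {i} → i < m → f i ≈ g i) → sumBelow R m f ≈ sumBelow R m g
  sumBelow-cong zero    f≈g = refl
  sumBelow-cong (suc m) f≈g = +-cong (sumBelow-cong m (λ i<m → f≈g (ℕₚ.m<n⇒m<1+n i<m))) (f≈g (ℕₚ.n<1+n m))

  sumBelow-+ : ∀ m (f g : ℕ → Carrier) → sumBelow R m (λ i → f i + g i) ≈ sumBelow R m f + sumBelow R m g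
  sumBelow-+ zero    f g = sym (+-identityˡ 0#)
  sumBelow-+ (suc m) f g = trans (+-congʳ (sumBelow-+ m f g)) (interchange _ _ _ _)

  sumBelow-*ˡ : ∀ m x (f : ℕ → Carrier) → sumBelow R m (λ i → x * f i) ≈ x * sumBelow R m f
  sumBelow-*ˡ zero    x f = sym (zeroʳ x)
  sumBelow-*ˡ (suc m) x f = trans (+-congʳ (sumBelow-*ˡ m x f)) (sym (distribˡ x _ _))

  sumBelow-suc : ∀ m (f : ℕ → Carrier) → sumBelow R (suc m) f ≈ f 0 + sumBelow R m (λ i → f (suc i))
  sumBelow-suc zero    f = +-comm 0# (f 0)
  sumBelow-suc (suc m) f = trans (+-congʳ (sumBelow-suc m f)) (+-assoc _ _ _)

  pow-∸ : ∀ {s i} → i < s → pow R h (s ∸ i) ≡ h * pow R h (s ∸ 1 ∸ i)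
  pow-∸ {s} {i} i<s = cong (pow R h) (≡.trans (ℕₚ.+-∸-assoc 1 i<s) (cong suc (≡.sym (ℕₚ.∸-+-assoc s 1 i))))

  horner-step : ∀ s (g : ℕ → Carrier) →
    sumBelow R (suc s) (λ i → g i * pow R h (suc s ∸ 1 ∸ i))
      ≈ h * sumBelow R s (λ i → g i * pow R h (s ∸ 1 ∸ i)) + g s
  horner-step s g = +-cong leading last
    where
    leading : sumBelow R s (λ i → g i * pow R h (s ∸ i)) ≈ h * sumBelow R s (λ i → g i * pow R h (s ∸ 1 ∸ i))
    leading = trans (sumBelow-cong s (λ i<s → trans (*-congˡ (reflexive (pow-∸ i<s))) (x∙yz≈y∙xz _ _ _)))
                    (sumBelow-*ˡ s h _)
    last : g s * pow R h (s ∸ s) ≈ g s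
    last = trans (*-congˡ (reflexive (cong (pow R h) (ℕₚ.n∸n≡0 s)))) (*-identityʳ (g s))

  horner-telescope : (u g : ℕ → Carrier) → (∀ i → u (suc (suc i)) ≈ h * u (suc i) + g i) →
    ∀ s → sumBelow R s (λ i → g i * pow R h (s ∸ 1 ∸ i)) ≈ u (suc s) - pow R h s * u 1
  horner-telescope u g rec zero = begin
      0#                  ≈⟨ sym (-‿inverseʳ (u 1)) ⟩
      u 1 - u 1           ≈⟨ +-congˡ (-‿cong (sym (*-identityˡ (u 1)))) ⟩
      u 1 - 1# * u 1      ∎
  horner-telescope u g rec (suc s) = begin
      sumBelow R (suc s) (λ i → g i * pow R h (s ∸ i))
    ≈⟨ horner-step s g ⟩
      h * sumBelow R s (λ i → g i * pow R h (s ∸ 1 ∸ i)) + g s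
    ≈⟨ +-congʳ (*-congˡ (horner-telescope u g rec s)) ⟩
      h * (u (suc s) - pow R h s * u 1) + g s
    ≈⟨ +-congʳ (x[y-z]≈xy-xz h _ _) ⟩
      (h * u (suc s) - h * (pow R h s * u 1)) + g s
    ≈⟨ xy∙z≈xz∙y _ _ _ ⟩
      (h * u (suc s) + g s) - h * (pow R h s * u 1)
    ≈⟨ +-cong (sym (rec s)) (-‿cong (sym (*-assoc h _ _))) ⟩
      u (suc (suc s)) - pow R h (suc s) * u 1
    ∎

  nat·≡× : ∀ k x → nat· R k x ≡ k × x
  nat·≡× zero    x = ≡.refl
  nat·≡× (suc k) x = cong (x +_) (nat·≡× k x)

  nat·-homo-+ : ∀ a b x → nat· R (a +ℕ b) x ≈ nat· R a x + nat· R b x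
  nat·-homo-+ a b x rewrite nat·≡× (a +ℕ b) x | nat·≡× a x | nat·≡× b x = ×-homo-+ x a b

  nat·-comm-* : ∀ k x → nat· R k (h * x) ≈ h * nat· R k x
  nat·-comm-* k x rewrite nat·≡× k (h * x) | nat·≡× k x = sym (×-comm-* k h x)

  lucasTerm : ℕ → ℕ → Carrier
  lucasTerm n i = nat· R (coeff n i) (pow R h (n ∸ 2 *ℕ i))

  lucasTerm-zero : ∀ n → lucasTerm (2 +ℕ n) 0 ≈ h * lucasTerm (1 +ℕ n) 0
  lucasTerm-zero n = begin
      nat· R (coeff (2 +ℕ n) 0) (h * pow R h (suc n))
    ≡⟨ cong (λ k → nat· R k (h * pow R h (suc n))) (≡.trans (coeff-zero (suc n)) (≡.sym (coeff-zero n))) ⟩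
      nat· R (coeff (1 +ℕ n) 0) (h * pow R h (suc n))
    ≈⟨ nat·-comm-* (coeff (1 +ℕ n) 0) _ ⟩
      h * lucasTerm (1 +ℕ n) 0
    ∎

  lucasTerm-rec : ∀ n i → 2 *ℕ i < n →
    lucasTerm (2 +ℕ n) (1 +ℕ i) ≈ h * lucasTerm (1 +ℕ n) (1 +ℕ i) + lucasTerm n i
  lucasTerm-rec n i 2i<n = begin
      nat· R (coeff (2 +ℕ n) (suc i)) (pow R h (2 +ℕ n ∸ 2 *ℕ suc i))
    ≡⟨ cong₂ (nat· R) (coeff-pascal i<n) (cong (pow R h) (≡.trans [2+n]-2[1+i]≡n-2i n-2i≡1+e)) ⟩
      nat· R (a +ℕ b) (h * p)
    ≈⟨ nat·-homo-+ a b _ ⟩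
      nat· R a (h * p) + nat· R b (h * p)
    ≈⟨ +-congʳ (nat·-comm-* a p) ⟩
      h * nat· R a p + nat· R b (pow R h (suc e))
    ≡⟨ cong₂ (λ x y → h * nat· R a (pow R h x) + nat· R b (pow R h y))
             (≡.sym (cong (suc n ∸_) (ℕₚ.*-suc 2 i))) (≡.sym n-2i≡1+e) ⟩
      h * lucasTerm (1 +ℕ n) (1 +ℕ i) + lucasTerm n i
    ∎
    where
    a = coeff (1 +ℕ n) (1 +ℕ i)
    b = coeff n i
    e = n ∸ suc (2 *ℕ i)
    p = pow R h e
    i<n : i < n
    i<n = ℕₚ.≤-trans (s≤s (ℕₚ.m≤m+n i (i +ℕ 0))) 2i<n
    n-2i≡1+e : n ∸ 2 *ℕ i ≡ suc e
    n-2i≡1+e = ℕₚ.+-∸-assoc 1 2i<n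
    [2+n]-2[1+i]≡n-2i : 2 +ℕ n ∸ 2 *ℕ suc i ≡ n ∸ 2 *ℕ i
    [2+n]-2[1+i]≡n-2i = cong (2 +ℕ n ∸_) (ℕₚ.*-suc 2 i)

  incLucas-rec : ∀ n l → suc (2 *ℕ l) ≤ n →
    incLucas R h (2 +ℕ n) (1 +ℕ l) ≈ h * incLucas R h (1 +ℕ n) (1 +ℕ l) + incLucas R h n l
  incLucas-rec n l 2l<n = begin
      sumBelow R (2 +ℕ l) (lucasTerm (2 +ℕ n))
    ≈⟨ sumBelow-suc (suc l) _ ⟩
      lucasTerm (2 +ℕ n) 0 + sumBelow R (suc l) (λ i → lucasTerm (2 +ℕ n) (suc i))
    ≈⟨ +-cong (lucasTerm-zero n) (sumBelow-cong (suc l) (λ {i} i<1+l → lucasTerm-rec n i (2i<n i<1+l))) ⟩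
      h * lucasTerm (1 +ℕ n) 0 + sumBelow R (suc l) (λ i → h * lucasTerm (1 +ℕ n) (suc i) + lucasTerm n i)
    ≈⟨ +-congˡ (trans (sumBelow-+ (suc l) _ _) (+-congʳ (sumBelow-*ˡ (suc l) h _))) ⟩
      h * lucasTerm (1 +ℕ n) 0 + (h * tail + incLucas R h n l)
    ≈⟨ sym (+-assoc _ _ _) ⟩
      (h * lucasTerm (1 +ℕ n) 0 + h * tail) + incLucas R h n l
    ≈⟨ +-congʳ (trans (sym (distribˡ h _ _)) (*-congˡ (sym (sumBelow-suc (suc l) (lucasTerm (1 +ℕ n)))))) ⟩
      h * incLucas R h (1 +ℕ n) (1 +ℕ l) + incLucas R h n l
    ∎
    where
    tail = sumBelow R (suc l) (λ i → lucasTerm (1 +ℕ n) (suc i))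
    2i<n : ∀ {i} → i < suc l → 2 *ℕ i < n
    2i<n (s≤s i≤l) = ℕₚ.≤-trans (s≤s (ℕₚ.*-monoʳ-≤ 2 i≤l)) 2l<n

proposition13 : {c ℓ : Level} (R : CommutativeRing c ℓ) (h : CommutativeRing.Carrier R)
    (l n s : ℕ) → suc (2 *ℕ l) ≤ n → 1 ≤ s →
    let open CommutativeRing R in
    sumBelow R s (λ i → incLucas R h (n +ℕ i) l * pow R h (s ∸ 1 ∸ i))
    ≈ incLucas R h (n +ℕ s +ℕ 1) (suc l) - pow R h s * incLucas R h (n +ℕ 1) (suc l)
proposition13 R h l n s 2l<n _ =
  trans (horner-telescope R h u (λ i → incLucas R h (n +ℕ i) l) u-rec s)
        (+-congʳ (reflexive (cong u′ (≡.trans (ℕₚ.+-suc n s) (ℕₚ.+-comm 1 (n +ℕ s))))))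
  where
  open CommutativeRing R
  u′ : ℕ → Carrier
  u′ m = incLucas R h m (suc l)
  u : ℕ → Carrier
  u m = u′ (n +ℕ m)
  u-rec : ∀ i → u (suc (suc i)) ≈ h * u (suc i) + incLucas R h (n +ℕ i) l
  u-rec i = begin
      u′ (n +ℕ suc (suc i))
    ≡⟨ cong u′ (≡.trans (ℕₚ.+-suc n (suc i)) (cong suc (ℕₚ.+-suc n i))) ⟩
      u′ (2 +ℕ (n +ℕ i))
    ≈⟨ incLucas-rec R h (n +ℕ i) l (ℕₚ.≤-trans 2l<n (ℕₚ.m≤m+n n i)) ⟩
      h * u′ (1 +ℕ (n +ℕ i)) + incLucas R h (n +ℕ i) l
    ≡⟨ cong (λ m → h * u′ m + incLucas R h (n +ℕ i) l) (≡.sym (ℕₚ.+-suc n i)) ⟩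
      h * u (suc i) + incLucas R h (n +ℕ i) l
    ∎
    where open SetoidReasoning setoid
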